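{- Let $L,n$ be positive integers. As maps on $\mathcal M(L,n)$, the dropping operators satisfy: (i) $(e_i^\star)^2=e_i^\star$ for $1\le i\le L-1$; (ii) $e_i^\star e_j^\star=e_j^\star e_i^\star$ whenever $|i-j|\ge2$; (iii) $e_i^\star e_{i+1}^\star e_i^\star=e_{i+1}^\star e_i^\star e_{i+1}^\star$ for $1\le i\le L-2$.
   Context: $\mathcal M(L,n)$ is the set of tuples $B=(B_1,\dots,B_L)$ of subsets of $\{1,\dots,n\}$ (binary $L\times n$ matrices), drawn as arrays with rows $1,\dots,L$ from bottom to top and columns $1,\dots,n$ from left to right, with a ball at site $(r,j)$ iff $j\in B_r$. The column word $\mathrm{cw}(B)$ records the row number of each ball, scanning columns from left to right and within each column from top to bottom. For a word $w$ and $i\ge1$, $\mathrm{Par}_i(w)$ is obtained by reading $w$ left to right, writing "(" for each letter $i+1$ and ")" for each letter $i$ (other letters ignored), and matching parentheses iteratively whenever an "(" is immediately followed by a ")" or separated from it only by already matched parentheses. A ball of row $i+1$ is unmatched above if its letter in $\mathrm{cw}(B)$ is unmatched in $\mathrm{Par}_i(\mathrm{cw}(B))$. The operator $e_i^\star$ moves every ball of row $i+1$ that is unmatched above down to row $i$ in the same column. Composition of operators is written multiplicatively and applied right to left. -}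

module Defs where

open import Data.Nat using (ℕ; zero; suc; _+_; _≡ᵇ_)
open import Data.Bool using (Bool; true; false; if_then_else_; _∧_; _∨_; not)
open import Data.Fin using (Fin; toℕ; _≟_)
open import Data.List using (List; []; _∷_; map; concatMap; reverse; length; zip; foldr)
open import Data.Bool.ListAction using (any)
open import Data.List.Base using (allFin)
open import Data.Vec using (Vec; lookup; tabulate)
open import Data.Maybe using (Maybe; just; nothing)
open import Data.Product using (_×_; _,_; proj₁; proj₂)
open import Relation.Nullary.Decidable using (⌊_⌋)

-- Row index (r : Fin L) stands for row number toℕ r + 1 (rows 1..L, bottom to top);
-- column index (j : Fin n) stands for column number toℕ j + 1 (left to right).
-- Entry true = a ball at that site; row r is the subset B_{r+1}.
Mat : ℕ → ℕ → Set
Mat L n = Vec (Vec Bool n) L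

ball : ∀ {L n} → Mat L n → Fin L → Fin n → Bool
ball B r j = lookup (lookup B r) j

rowNum : ∀ {L} → Fin L → ℕ
rowNum r = suc (toℕ r)

-- The balls of B in column-word order: columns left to right, within a column top to bottom.
sites : ∀ {L n} → Mat L n → List (Fin L × Fin n)
sites {L} {n} B =
  concatMap (λ j → concatMap (λ r → if ball B r j then (r , j) ∷ [] else [])
                             (reverse (allFin L)))
            (allFin n)

cw : ∀ {L n} → Mat L n → List ℕ
cw B = map (λ s → rowNum (proj₁ s)) (sites B)

-- Letters of Par_i(w): "(" , ")" , or an ignored letter.
data Tok : Set where
  op cl ot : Tok

tokOf : ℕ → ℕ → Tok
tokOf i a = if a ≡ᵇ suc i then op else (if a ≡ᵇ i then cl else ot)

-- A token together with a flag recording whether it is already matched.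
MTok : Set
MTok = Tok × Bool

tryClose : List MTok → Maybe (List MTok)
tryClose [] = nothing
tryClose ((ot , m) ∷ xs) with tryClose xs
... | just ys = just ((ot , m) ∷ ys)
... | nothing = nothing
tryClose ((t , true) ∷ xs) with tryClose xs
... | just ys = just ((t , true) ∷ ys)
... | nothing = nothing
tryClose ((op , false) ∷ xs) = nothing
tryClose ((cl , false) ∷ xs) = just ((cl , true) ∷ xs)

matchStep : List MTok → List MTok
matchStep [] = []
matchStep ((op , false) ∷ xs) with tryClose xs
... | just ys = (op , true) ∷ ys
... | nothing = (op , false) ∷ matchStep xs
matchStep (x ∷ xs) = x ∷ matchStep xs

iterate : ℕ → (List MTok → List MTok) → List MTok → List MTok
iterate zero f xs = xs
iterate (suc k) f xs = iterate k f (f xs)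

-- Par_i(w) with its final matching: iterate the matching step until nothing changes
-- (each effective step matches two letters, so length w iterations suffice).
par : ℕ → List ℕ → List MTok
par i w = iterate (length w) matchStep (map (λ a → (tokOf i a , false)) w)

isUnmatchedOpen : MTok → Bool
isUnmatchedOpen (op , false) = true
isUnmatchedOpen _ = false

unmatchedCols : ∀ {L n} → ℕ → Mat L n → List (Fin n)
unmatchedCols i B =
  foldr (λ p acc → if isUnmatchedOpen (proj₂ p) then proj₂ (proj₁ p) ∷ acc else acc)
        [] (zip (sites B) (par i (cw B)))

memFin : ∀ {n} → Fin n → List (Fin n) → Bool
memFin j js = any (λ k → ⌊ k ≟ j ⌋) js

drop⋆ : ∀ {L n} → ℕ → Mat L n → Mat L n
drop⋆ {L} {n} i B =
  tabulate λ r → tabulate λ j →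
    let S = memFin j (unmatchedCols i B) in
    if rowNum r ≡ᵇ i then (ball B r j ∨ S)
    else (if rowNum r ≡ᵇ suc i then (ball B r j ∧ not S) else ball B r j)

{-# OPTIONS --safe #-}
module Submission where

-- Read from right to left with a counter c of the ")" still waiting for a partner, Par_i
-- leaves a "(" unmatched exactly when it is met with c = 0, so the iterated matching can be
-- replaced by one right-to-left scan. In the column word a column contributes "(" for a ball
-- in row i+1 followed by ")" for a ball in row i; hence e_i^⋆ is a transducer which reads the
-- columns from right to left, keeps c as its state and only looks at and changes rows i and
-- i+1. Composites of transducers are transducers on product states, and each relation becomes
-- a simulation between two composites: (i) the second pass has a counter at least as large as
-- the first one and never drops a ball; (ii) the two operators touch disjoint rows; (iii) on
-- rows i, i+1, i+2 the six counters of the two composites stay functions of three parameters.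

open import Defs
open import Function using (_∘_; id)
open import Data.Bool using (Bool; true; false; if_then_else_; _∧_; _∨_; not)
open import Data.Nat using (ℕ; zero; suc; pred; _+_; _≤_; _<_; z≤n; s≤s; _≡ᵇ_)
open import Data.Nat.Properties
  using (_≟_; ≤-trans; ≤-pred; n≤1+n; n≮0; m≤n⇒m≤1+n; <⇒≤; <⇒≢; m<n⇒m<1+n; 1+n≢n; ≤-<-connex;
         +-comm; +-suc; +-identityʳ)
open import Data.Integer using (ℤ; +_; -[1+_])
open import Data.Fin using (Fin; toℕ) renaming (_≟_ to _≟ᶠ_)
open import Data.List using (List; []; _∷_; map; foldr; length; zip; concatMap; reverse; allFin; _∷ʳ_)
open import Data.List.Properties
  using (length-map; map-∘; map-cong; map-cong-local; map-tabulate; ∷-injectiveˡ; ∷-injectiveʳ;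
         foldr-++; foldr-∷ʳ; foldr-map; foldr-cong; unfold-reverse; reverse-map)
open import Data.List.Relation.Unary.All as All using (All; []; _∷_)
open import Data.List.Relation.Unary.AllPairs using ([]; _∷_)
open import Data.List.Relation.Unary.Any using (here; there)
open import Data.List.Relation.Unary.Unique.Propositional using (Unique)
open import Data.List.Relation.Unary.Unique.Propositional.Properties using (allFin⁺)
open import Data.List.Membership.Propositional using (_∈_)
open import Data.List.Membership.Propositional.Properties using (∈-allFin)
open import Data.Maybe using (just; nothing)
open import Data.Vec using (Vec; []; _∷_; lookup; tabulate)
open import Data.Vec.Properties using (lookup∘tabulate; tabulate∘lookup; tabulate-cong)
open import Data.Product using (Σ; _×_; _,_; proj₁; proj₂; map₂)
open import Data.Sum using (_⊎_; inj₁; inj₂)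
open import Data.Empty using (⊥-elim)
open import Relation.Nullary using (yes; no)
open import Relation.Nullary.Decidable using (dec-true; dec-false)
open import Relation.Binary.PropositionalEquality

Transducer : Set → Set → Set
Transducer S X = S → X → X × S

run : ∀ {S X} → Transducer S X → S → List X → List X × S
run m s []       = [] , s
run m s (x ∷ xs) = let (ys , t) = run m s xs ; (y , u) = m t x in y ∷ ys , u

_⊙_ : ∀ {S T X} → Transducer S X → Transducer T X → Transducer (S × T) X
(f ⊙ g) (s , t) x = let (y , t′) = g t x ; (z , s′) = f s y in z , (s′ , t′)

run-⊙ : ∀ {S T X} (f : Transducer S X) (g : Transducer T X) s t xs →
        run (f ⊙ g) (s , t) xs ≡ (let (ys , t′) = run g t xs ; (zs , s′) = run f s ys in zs , (s′ , t′))
run-⊙ f g s t []       = refl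
run-⊙ f g s t (x ∷ xs) rewrite run-⊙ f g s t xs = refl

Simulation : ∀ {S T X} → Transducer S X → Transducer T X → (S → T → Set) → Set
Simulation f g R =
  ∀ {s t} x → R s t → proj₁ (f s x) ≡ proj₁ (g t x) × R (proj₂ (f s x)) (proj₂ (g t x))

run-simulation : ∀ {S T X} {f : Transducer S X} {g : Transducer T X} {R s t} →
                 Simulation f g R → R s t → ∀ xs →
                 proj₁ (run f s xs) ≡ proj₁ (run g t xs) × R (proj₂ (run f s xs)) (proj₂ (run g t xs))
run-simulation sim r []       = refl , r
run-simulation sim r (x ∷ xs) =
  let same , related = run-simulation sim r xs
  in cong₂ _∷_ (proj₁ (sim x related)) same , proj₂ (sim x related)

-- The matching of Par_i

scanStep : MTok → List Bool × ℕ → List Bool × ℕ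
scanStep (op , false) (bs , c) = (c ≡ᵇ 0) ∷ bs , pred c
scanStep (cl , false) (bs , c) = false ∷ bs , suc c
scanStep _            (bs , c) = false ∷ bs , c

unmatchedScan : List MTok → List Bool × ℕ
unmatchedScan = foldr scanStep ([] , 0)

tryClose-unmatchedScan : ∀ xs {ys} → tryClose xs ≡ just ys → unmatchedScan xs ≡ map₂ suc (unmatchedScan ys)
tryClose-unmatchedScan ((ot , m) ∷ xs) eq with tryClose xs in e
tryClose-unmatchedScan ((ot , m) ∷ xs) refl | just ys =
  cong (scanStep (ot , m)) (tryClose-unmatchedScan xs e)
tryClose-unmatchedScan ((op , true) ∷ xs) eq with tryClose xs in e
tryClose-unmatchedScan ((op , true) ∷ xs) refl | just ys =
  cong (scanStep (op , true)) (tryClose-unmatchedScan xs e)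
tryClose-unmatchedScan ((cl , true) ∷ xs) eq with tryClose xs in e
tryClose-unmatchedScan ((cl , true) ∷ xs) refl | just ys =
  cong (scanStep (cl , true)) (tryClose-unmatchedScan xs e)
tryClose-unmatchedScan ((cl , false) ∷ xs) refl = refl

matchStep-unmatchedScan : ∀ xs → unmatchedScan (matchStep xs) ≡ unmatchedScan xs
matchStep-unmatchedScan [] = refl
matchStep-unmatchedScan ((op , false) ∷ xs) with tryClose xs in e
... | just ys = sym (cong (scanStep (op , false)) (tryClose-unmatchedScan xs e))
... | nothing = cong (scanStep (op , false)) (matchStep-unmatchedScan xs)
matchStep-unmatchedScan ((op , true) ∷ xs) = cong (scanStep (op , true)) (matchStep-unmatchedScan xs)
matchStep-unmatchedScan ((cl , m) ∷ xs)    = cong (scanStep (cl , m)) (matchStep-unmatchedScan xs)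
matchStep-unmatchedScan ((ot , m) ∷ xs)    = cong (scanStep (ot , m)) (matchStep-unmatchedScan xs)

iterate-unmatchedScan : ∀ k xs → unmatchedScan (iterate k matchStep xs) ≡ unmatchedScan xs
iterate-unmatchedScan zero    xs = refl
iterate-unmatchedScan (suc k) xs = trans (iterate-unmatchedScan k (matchStep xs)) (matchStep-unmatchedScan xs)

unmatchedCount : List MTok → ℕ
unmatchedCount []                  = 0
unmatchedCount ((op , false) ∷ xs) = suc (unmatchedCount xs)
unmatchedCount ((cl , false) ∷ xs) = suc (unmatchedCount xs)
unmatchedCount (_ ∷ xs)            = unmatchedCount xs

unmatchedCount≤length : ∀ xs → unmatchedCount xs ≤ length xs
unmatchedCount≤length []                  = z≤n
unmatchedCount≤length ((op , false) ∷ xs) = s≤s (unmatchedCount≤length xs)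
unmatchedCount≤length ((op , true) ∷ xs)  = m≤n⇒m≤1+n (unmatchedCount≤length xs)
unmatchedCount≤length ((cl , false) ∷ xs) = s≤s (unmatchedCount≤length xs)
unmatchedCount≤length ((cl , true) ∷ xs)  = m≤n⇒m≤1+n (unmatchedCount≤length xs)
unmatchedCount≤length ((ot , m) ∷ xs)     = m≤n⇒m≤1+n (unmatchedCount≤length xs)

tryClose-unmatchedCount : ∀ xs {ys} → tryClose xs ≡ just ys → unmatchedCount xs ≡ suc (unmatchedCount ys)
tryClose-unmatchedCount ((ot , m) ∷ xs) eq with tryClose xs in e
tryClose-unmatchedCount ((ot , m) ∷ xs) refl | just ys = tryClose-unmatchedCount xs e
tryClose-unmatchedCount ((op , true) ∷ xs) eq with tryClose xs in e
tryClose-unmatchedCount ((op , true) ∷ xs) refl | just ys = tryClose-unmatchedCount xs e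
tryClose-unmatchedCount ((cl , true) ∷ xs) eq with tryClose xs in e
tryClose-unmatchedCount ((cl , true) ∷ xs) refl | just ys = tryClose-unmatchedCount xs e
tryClose-unmatchedCount ((cl , false) ∷ xs) refl = refl

matchStep-fixed-or-shrinks : ∀ xs → matchStep xs ≡ xs ⊎ unmatchedCount (matchStep xs) < unmatchedCount xs
matchStep-fixed-or-shrinks [] = inj₁ refl
matchStep-fixed-or-shrinks ((op , false) ∷ xs) with tryClose xs in e
... | just ys rewrite tryClose-unmatchedCount xs e = inj₂ (s≤s (n≤1+n _))
... | nothing with matchStep-fixed-or-shrinks xs
...   | inj₁ fixed   = inj₁ (cong ((op , false) ∷_) fixed)
...   | inj₂ shrinks = inj₂ (s≤s shrinks)
matchStep-fixed-or-shrinks ((cl , false) ∷ xs) with matchStep-fixed-or-shrinks xs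
... | inj₁ fixed   = inj₁ (cong ((cl , false) ∷_) fixed)
... | inj₂ shrinks = inj₂ (s≤s shrinks)
matchStep-fixed-or-shrinks ((op , true) ∷ xs) with matchStep-fixed-or-shrinks xs
... | inj₁ fixed   = inj₁ (cong ((op , true) ∷_) fixed)
... | inj₂ shrinks = inj₂ shrinks
matchStep-fixed-or-shrinks ((cl , true) ∷ xs) with matchStep-fixed-or-shrinks xs
... | inj₁ fixed   = inj₁ (cong ((cl , true) ∷_) fixed)
... | inj₂ shrinks = inj₂ shrinks
matchStep-fixed-or-shrinks ((ot , m) ∷ xs) with matchStep-fixed-or-shrinks xs
... | inj₁ fixed   = inj₁ (cong ((ot , m) ∷_) fixed)
... | inj₂ shrinks = inj₂ shrinks

iterate-fixed : ∀ {f : List MTok → List MTok} {xs} k → f xs ≡ xs → iterate k f xs ≡ xs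
iterate-fixed zero          fixed = refl
iterate-fixed {f} (suc k) fixed rewrite fixed = iterate-fixed {f} k fixed

iterate-reaches-fixed : ∀ k xs → unmatchedCount xs ≤ k →
                        matchStep (iterate k matchStep xs) ≡ iterate k matchStep xs
iterate-reaches-fixed k xs bound with matchStep-fixed-or-shrinks xs
iterate-reaches-fixed k xs bound | inj₁ fixed rewrite iterate-fixed {matchStep} k fixed = fixed
iterate-reaches-fixed zero xs bound | inj₂ shrinks = ⊥-elim (n≮0 (≤-trans shrinks bound))
iterate-reaches-fixed (suc k) xs bound | inj₂ shrinks =
  iterate-reaches-fixed k (matchStep xs) (≤-pred (≤-trans shrinks bound))

fixed-unmatchedScan : ∀ xs → matchStep xs ≡ xs →
  proj₁ (unmatchedScan xs) ≡ map isUnmatchedOpen xs × (tryClose xs ≡ nothing → proj₂ (unmatchedScan xs) ≡ 0)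
fixed-unmatchedScan [] fixed = refl , λ _ → refl
fixed-unmatchedScan ((op , false) ∷ xs) fixed with tryClose xs in e
fixed-unmatchedScan ((op , false) ∷ xs) () | just _
... | nothing with fixed-unmatchedScan xs (∷-injectiveʳ fixed)
...   | flags , noPending rewrite noPending e = cong (true ∷_) flags , λ _ → refl
fixed-unmatchedScan ((cl , false) ∷ xs) fixed =
  cong (false ∷_) (proj₁ (fixed-unmatchedScan xs (∷-injectiveʳ fixed))) , λ ()
fixed-unmatchedScan ((op , true) ∷ xs) fixed with fixed-unmatchedScan xs (∷-injectiveʳ fixed) | tryClose xs in e
... | flags , _         | just _  = cong (false ∷_) flags , λ ()
... | flags , noPending | nothing = cong (false ∷_) flags , λ _ → noPending e
fixed-unmatchedScan ((cl , true) ∷ xs) fixed with fixed-unmatchedScan xs (∷-injectiveʳ fixed) | tryClose xs in e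
... | flags , _         | just _  = cong (false ∷_) flags , λ ()
... | flags , noPending | nothing = cong (false ∷_) flags , λ _ → noPending e
fixed-unmatchedScan ((ot , m) ∷ xs) fixed with fixed-unmatchedScan xs (∷-injectiveʳ fixed) | tryClose xs in e
... | flags , _         | just _  = cong (false ∷_) flags , λ ()
... | flags , noPending | nothing = cong (false ∷_) flags , λ _ → noPending e

initialTokens : ℕ → List ℕ → List MTok
initialTokens i = map λ a → tokOf i a , false

par-unmatchedScan : ∀ i w → map isUnmatchedOpen (par i w) ≡ proj₁ (unmatchedScan (initialTokens i w))
par-unmatchedScan i w = begin
  map isUnmatchedOpen (par i w)
    ≡⟨ proj₁ (fixed-unmatchedScan (par i w) reachesFixed) ⟨
  proj₁ (unmatchedScan (par i w))
    ≡⟨ cong proj₁ (iterate-unmatchedScan (length w) (initialTokens i w)) ⟩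
  proj₁ (unmatchedScan (initialTokens i w)) ∎
  where
  open ≡-Reasoning
  reachesFixed : matchStep (par i w) ≡ par i w
  reachesFixed = iterate-reaches-fixed (length w) (initialTokens i w)
    (subst (unmatchedCount (initialTokens i w) ≤_) (length-map _ w) (unmatchedCount≤length (initialTokens i w)))

-- Row k of a column, counted from 0 at the bottom; false above the top row.
bit : ∀ {L} → Vec Bool L → ℕ → Bool
bit []      k       = false
bit (b ∷ v) zero    = b
bit (b ∷ v) (suc k) = bit v k

bit-ext : ∀ {L} {v w : Vec Bool L} → (∀ k → bit v k ≡ bit w k) → v ≡ w
bit-ext {v = []}    {[]}    _  = refl
bit-ext {v = b ∷ v} {c ∷ w} eq = cong₂ _∷_ (eq 0) (bit-ext (eq ∘ suc))

bit-beyond : ∀ {L} (v : Vec Bool L) {k} → L ≤ k → bit v k ≡ false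
bit-beyond []      _         = refl
bit-beyond (b ∷ v) (s≤s L≤k) = bit-beyond v L≤k

bit-tabulate : ∀ {L} (g : ℕ → Bool → Bool) (v : Vec Bool L) {k} → k < L →
               bit (tabulate λ r → g (toℕ r) (lookup v r)) k ≡ g k (bit v k)
bit-tabulate g (b ∷ v) {zero}  _         = refl
bit-tabulate g (b ∷ v) {suc k} (s≤s k<L) = bit-tabulate (g ∘ suc) v k<L

-- Here i and m are row numbers counted from 1, as in drop⋆.
moveEntry : ℕ → Bool → ℕ → Bool → Bool
moveEntry i S m b = if m ≡ᵇ i then b ∨ S else (if m ≡ᵇ suc i then b ∧ not S else b)

moveDown : ∀ {L} → ℕ → Bool → Vec Bool L → Vec Bool L
moveDown i S v = tabulate λ r → moveEntry i S (rowNum r) (lookup v r)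

≡ᵇ-true : ∀ m → (m ≡ᵇ m) ≡ true
≡ᵇ-true m = dec-true (m ≟ m) refl

≡ᵇ-false : ∀ {m n} → m ≢ n → (m ≡ᵇ n) ≡ false
≡ᵇ-false {m} {n} = dec-false (m ≟ n)

moveEntry-outside : ∀ {i m} → m ≢ i → m ≢ suc i → ∀ S b → moveEntry i S m b ≡ b
moveEntry-outside m≢i m≢i+1 S b rewrite ≡ᵇ-false m≢i | ≡ᵇ-false m≢i+1 = refl

module _ {L : ℕ} (k : ℕ) (S : Bool) (v : Vec Bool L) where

  bit-moveDown-lower : k < L → bit (moveDown (suc k) S v) k ≡ bit v k ∨ S
  bit-moveDown-lower k<L rewrite bit-tabulate (moveEntry (suc k) S ∘ suc) v k<L | ≡ᵇ-true k = refl

  bit-moveDown-upper : suc k < L → bit (moveDown (suc k) S v) (suc k) ≡ bit v (suc k) ∧ not S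
  bit-moveDown-upper k+1<L
    rewrite bit-tabulate (moveEntry (suc k) S ∘ suc) v k+1<L | ≡ᵇ-false (1+n≢n {k}) | ≡ᵇ-true k = refl

  bit-moveDown-other : ∀ m → m ≢ k → m ≢ suc k → bit (moveDown (suc k) S v) m ≡ bit v m
  bit-moveDown-other m m≢k m≢k+1 with ≤-<-connex L m
  ... | inj₁ L≤m = trans (bit-beyond (moveDown (suc k) S v) L≤m) (sym (bit-beyond v L≤m))
  ... | inj₂ m<L = trans (bit-tabulate (moveEntry (suc k) S ∘ suc) v m<L)
                         (moveEntry-outside {suc k} {suc m} (m≢k ∘ cong pred) (m≢k+1 ∘ cong pred) S (bit v m))

-- One column in the scan of Par_i, read bottom-up: a ball in row i is a ")", then a ball in
-- row i+1 is a "(", so only a lone upper ball can be unmatched.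
dropFlag : Bool → Bool → ℕ → Bool
dropFlag false true zero = true
dropFlag _     _    _    = false

pending : Bool → Bool → ℕ → ℕ
pending false true  c = pred c
pending true  false c = suc c
pending _     _     c = c

dropFlagAt : ∀ {L} → ℕ → ℕ → Vec Bool L → Bool
dropFlagAt k c v = dropFlag (bit v k) (bit v (suc k)) c

pendingAt : ∀ {L} → ℕ → ℕ → Vec Bool L → ℕ
pendingAt k c v = pending (bit v k) (bit v (suc k)) c

dropStep : ∀ {L} → ℕ → Transducer ℕ (Vec Bool L)
dropStep k c v = moveDown (suc k) (dropFlagAt k c v) v , pendingAt k c v

-- drop⋆ as a transducer on columns

Marks : ℕ → Set
Marks n = List (Fin n) × ℕ

tokStep : ∀ {n} → Tok → Fin n → Marks n → Marks n
tokStep op j (js , c) = (if c ≡ᵇ 0 then j ∷ js else js) , pred c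
tokStep cl j (js , c) = js , suc c
tokStep ot j s        = s

siteStep : ∀ {L n} → ℕ → Fin L × Fin n → Marks n → Marks n
siteStep i (r , j) = tokStep (tokOf i (rowNum r)) j

siteTokens : ∀ {L n} → ℕ → List (Fin L × Fin n) → List MTok
siteTokens i = map λ s → tokOf i (rowNum (proj₁ s)) , false

keepFlagged : ∀ {L n} → (Fin L × Fin n) × Bool → List (Fin n) → List (Fin n)
keepFlagged ((r , j) , b) js = if b then j ∷ js else js

keepFlagged-isUnmatchedOpen : ∀ {L n} (ss : List (Fin L × Fin n)) ps →
  foldr (λ p js → if isUnmatchedOpen (proj₂ p) then proj₂ (proj₁ p) ∷ js else js) [] (zip ss ps)
  ≡ foldr keepFlagged [] (zip ss (map isUnmatchedOpen ps))
keepFlagged-isUnmatchedOpen []       ps       = refl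
keepFlagged-isUnmatchedOpen (s ∷ ss) []       = refl
keepFlagged-isUnmatchedOpen (s ∷ ss) (p ∷ ps) =
  cong (keepFlagged (s , isUnmatchedOpen p)) (keepFlagged-isUnmatchedOpen ss ps)

siteStep-unmatchedScan : ∀ {L n} i (ss : List (Fin L × Fin n)) →
  foldr keepFlagged [] (zip ss (proj₁ (unmatchedScan (siteTokens i ss)))) ≡ proj₁ (foldr (siteStep i) ([] , 0) ss)
  × proj₂ (unmatchedScan (siteTokens i ss)) ≡ proj₂ (foldr (siteStep i) ([] , 0) ss)
siteStep-unmatchedScan i [] = refl , refl
siteStep-unmatchedScan i ((r , j) ∷ ss) with siteStep-unmatchedScan i ss
... | marks , count with tokOf i (rowNum r)
... | op rewrite marks | count = refl , refl
... | cl rewrite marks | count = refl , refl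
... | ot rewrite marks | count = refl , refl

unmatchedCols-siteStep : ∀ {L n} i (B : Mat L n) →
                         unmatchedCols i B ≡ proj₁ (foldr (siteStep i) ([] , 0) (sites B))
unmatchedCols-siteStep i B = begin
  unmatchedCols i B
    ≡⟨ keepFlagged-isUnmatchedOpen (sites B) (par i (cw B)) ⟩
  foldr keepFlagged [] (zip (sites B) (map isUnmatchedOpen (par i (cw B))))
    ≡⟨ cong (foldr keepFlagged [] ∘ zip (sites B)) (par-unmatchedScan i (cw B)) ⟩
  foldr keepFlagged [] (zip (sites B) (proj₁ (unmatchedScan (initialTokens i (cw B)))))
    ≡⟨ cong (λ ts → foldr keepFlagged [] (zip (sites B) (proj₁ (unmatchedScan ts)))) (map-∘ (sites B)) ⟨
  foldr keepFlagged [] (zip (sites B) (proj₁ (unmatchedScan (siteTokens i (sites B)))))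
    ≡⟨ proj₁ (siteStep-unmatchedScan i (sites B)) ⟩
  proj₁ (foldr (siteStep i) ([] , 0) (sites B)) ∎
  where open ≡-Reasoning

foldr-concatMap : ∀ {A B C : Set} (f : B → C → C) (g : A → List B) e xs →
                  foldr f e (concatMap g xs) ≡ foldr (λ x s → foldr f s (g x)) e xs
foldr-concatMap f g e []       = refl
foldr-concatMap f g e (x ∷ xs) =
  trans (foldr-++ f e (g x) (concatMap g xs)) (cong (λ s → foldr f s (g x)) (foldr-concatMap f g e xs))

foldr-fixes : ∀ {A B : Set} {f : A → B → B} {e} → (∀ x → f x e ≡ e) → ∀ xs → foldr f e xs ≡ e
foldr-fixes         fixes []       = refl
foldr-fixes {f = f} fixes (x ∷ xs) = trans (cong (f x) (foldr-fixes fixes xs)) (fixes x)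

foldr-reverse-allFin : ∀ {A : Set} {L} (f : Fin (suc L) → A → A) e →
                       foldr f e (reverse (allFin (suc L)))
                       ≡ foldr (f ∘ Fin.suc) (f Fin.zero e) (reverse (allFin L))
foldr-reverse-allFin {L = L} f e = begin
  foldr f e (reverse (allFin (suc L)))
    ≡⟨ cong (λ xs → foldr f e (reverse (Fin.zero ∷ xs))) (map-tabulate id Fin.suc) ⟨
  foldr f e (reverse (Fin.zero ∷ map Fin.suc (allFin L)))
    ≡⟨ cong (foldr f e) (unfold-reverse Fin.zero (map Fin.suc (allFin L))) ⟩
  foldr f e (reverse (map Fin.suc (allFin L)) ∷ʳ Fin.zero)
    ≡⟨ foldr-∷ʳ f e Fin.zero (reverse (map Fin.suc (allFin L))) ⟩
  foldr f (f Fin.zero e) (reverse (map Fin.suc (allFin L)))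
    ≡⟨ cong (foldr f (f Fin.zero e)) (reverse-map Fin.suc (allFin L)) ⟨
  foldr f (f Fin.zero e) (map Fin.suc (reverse (allFin L)))
    ≡⟨ foldr-map f Fin.suc (f Fin.zero e) (reverse (allFin L)) ⟩
  foldr (f ∘ Fin.suc) (f Fin.zero e) (reverse (allFin L)) ∎
  where open ≡-Reasoning

scanRows : ∀ {L n} → (ℕ → Tok) → Vec Bool L → Fin n → Marks n → Marks n
scanRows t v j s = foldr (λ r s → if lookup v r then tokStep (t (toℕ r)) j s else s) s (reverse (allFin _))

scanRows-∷ : ∀ {L n} t b (v : Vec Bool L) (j : Fin n) s →
             scanRows t (b ∷ v) j s ≡ scanRows (t ∘ suc) v j (if b then tokStep (t 0) j s else s)
scanRows-∷ t b v j s = foldr-reverse-allFin (λ r s → if lookup (b ∷ v) r then tokStep (t (toℕ r)) j s else s) s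

scanRows-ot : ∀ {L n} {t} → (∀ m → t m ≡ ot) → ∀ (v : Vec Bool L) (j : Fin n) s → scanRows t v j s ≡ s
scanRows-ot {t = t} other v j s = foldr-fixes fixes (reverse (allFin _))
  where
  fixes : ∀ r → (if lookup v r then tokStep (t (toℕ r)) j s else s) ≡ s
  fixes r rewrite other (toℕ r) with lookup v r
  ... | true  = refl
  ... | false = refl

colScan : ∀ {L n} → ℕ → Vec Bool L → Fin n → Marks n → Marks n
colScan k v j (js , c) = (if dropFlagAt k c v then j ∷ js else js) , pendingAt k c v

scanRows-colScan : ∀ {L n} k (v : Vec Bool L) (j : Fin n) s →
                   scanRows (tokOf (suc k) ∘ suc) v j s ≡ colScan k v j s
scanRows-colScan zero [] j s = refl
scanRows-colScan zero (p ∷ []) j s rewrite scanRows-∷ (tokOf 1 ∘ suc) p [] j s with p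
... | true  = refl
... | false = refl
scanRows-colScan zero (p ∷ q ∷ v) j (js , c) =
  trans (scanRows-∷ (tokOf 1 ∘ suc) p (q ∷ v) j (js , c))
    (trans (scanRows-∷ (tokOf 1 ∘ suc ∘ suc) q v j _)
      (trans (scanRows-ot {t = tokOf 1 ∘ suc ∘ suc ∘ suc} (λ _ → refl) v j _) (closeThenOpen p q c)))
  where
  closeThenOpen : ∀ p q c → (if q then tokStep op j (if p then tokStep cl j (js , c) else (js , c))
                                  else (if p then tokStep cl j (js , c) else (js , c)))
                            ≡ ((if dropFlag p q c then j ∷ js else js) , pending p q c)
  closeThenOpen false false _       = refl
  closeThenOpen false true  zero    = refl
  closeThenOpen false true  (suc _) = refl
  closeThenOpen true  false _       = refl
  closeThenOpen true  true  _       = refl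
scanRows-colScan (suc k) [] j s = refl
scanRows-colScan (suc k) (b ∷ v) j s rewrite scanRows-∷ (tokOf (suc (suc k)) ∘ suc) b v j s with b
... | true  = scanRows-colScan k v j s
... | false = scanRows-colScan k v j s

markedColumns : ∀ {L n} → ℕ → (Fin n → Vec Bool L) → List (Fin n) → Marks n
markedColumns k C = foldr (λ j → colScan k (C j) j) ([] , 0)

col : ∀ {L n} → Mat L n → Fin n → Vec Bool L
col B j = tabulate λ r → ball B r j

columns : ∀ {L n} → Mat L n → List (Vec Bool L)
columns {n = n} B = map (col B) (allFin n)

unmatchedCols-markedColumns : ∀ {L n} k (B : Mat L n) →
                              unmatchedCols (suc k) B ≡ proj₁ (markedColumns k (col B) (allFin n))
unmatchedCols-markedColumns {L} {n} k B = begin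
  unmatchedCols (suc k) B
    ≡⟨ unmatchedCols-siteStep (suc k) B ⟩
  proj₁ (foldr (siteStep (suc k)) ([] , 0) (sites B))
    ≡⟨ cong proj₁ (foldr-concatMap (siteStep (suc k)) columnSites ([] , 0) (allFin n)) ⟩
  proj₁ (foldr (λ j s → foldr (siteStep (suc k)) s (columnSites j)) ([] , 0) (allFin n))
    ≡⟨ cong proj₁ (foldr-cong column refl (allFin n)) ⟩
  proj₁ (markedColumns k (col B) (allFin n)) ∎
  where
  open ≡-Reasoning
  columnSites : Fin n → List (Fin L × Fin n)
  columnSites j = concatMap (λ r → if ball B r j then (r , j) ∷ [] else []) (reverse (allFin L))
  site : ∀ j r s → foldr (siteStep (suc k)) s (if ball B r j then (r , j) ∷ [] else [])
                   ≡ (if lookup (col B j) r then tokStep (tokOf (suc k) (rowNum r)) j s else s)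
  site j r s rewrite lookup∘tabulate (λ r → ball B r j) r with ball B r j
  ... | true  = refl
  ... | false = refl
  column : ∀ j s → foldr (siteStep (suc k)) s (columnSites j) ≡ colScan k (col B j) j s
  column j s = trans (foldr-concatMap (siteStep (suc k)) _ s (reverse (allFin L)))
                     (trans (foldr-cong (site j) refl (reverse (allFin L))) (scanRows-colScan k (col B j) j s))

memFin-if-self : ∀ {n} (j : Fin n) b {js} → memFin j js ≡ false → memFin j (if b then j ∷ js else js) ≡ b
memFin-if-self j true  _ with j ≟ᶠ j
... | yes _  = refl
... | no j≢j = ⊥-elim (j≢j refl)
memFin-if-self j false absent = absent

memFin-if-other : ∀ {n} {i j : Fin n} b js → i ≢ j → memFin j (if b then i ∷ js else js) ≡ memFin j js
memFin-if-other {i = i} {j} true js i≢j with i ≟ᶠ j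
... | yes i≡j = ⊥-elim (i≢j i≡j)
... | no _    = refl
memFin-if-other false js _ = refl

memFin-markedColumns : ∀ {L n} k (C : Fin n → Vec Bool L) {j} js → All (j ≢_) js →
                       memFin j (proj₁ (markedColumns k C js)) ≡ false
memFin-markedColumns k C []       []           = refl
memFin-markedColumns k C (i ∷ js) (j≢i ∷ j∉js) =
  trans (memFin-if-other (dropFlagAt k (proj₂ (markedColumns k C js)) (C i)) (proj₁ (markedColumns k C js))
                         (≢-sym j≢i))
        (memFin-markedColumns k C js j∉js)

markedColumns-run : ∀ {L n} k (C : Fin n → Vec Bool L) js → Unique js →
  map (λ j → moveDown (suc k) (memFin j (proj₁ (markedColumns k C js))) (C j)) js
  ≡ proj₁ (run (dropStep k) 0 (map C js))
  × proj₂ (markedColumns k C js) ≡ proj₂ (run (dropStep k) 0 (map C js))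
markedColumns-run k C []       []              = refl , refl
markedColumns-run {n = n} k C (j ∷ js) (j∉js ∷ unique) with markedColumns-run k C js unique
... | moved , samePending rewrite sym samePending = cong₂ _∷_ head tail , refl
  where
  flag : Bool
  flag = dropFlagAt k (proj₂ (markedColumns k C js)) (C j)
  marked : List (Fin n)
  marked = proj₁ (markedColumns k C js)
  head : moveDown (suc k) (memFin j (if flag then j ∷ marked else marked)) (C j) ≡ moveDown (suc k) flag (C j)
  head = cong (λ b → moveDown (suc k) b (C j)) (memFin-if-self j flag (memFin-markedColumns k C js j∉js))
  tail : map (λ i → moveDown (suc k) (memFin i (if flag then j ∷ marked else marked)) (C i)) js
         ≡ proj₁ (run (dropStep k) 0 (map C js))
  tail = trans (map-cong-local (All.map (λ j≢i → cong (λ b → moveDown (suc k) b (C _)) (memFin-if-other flag _ j≢i))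
                                        j∉js))
               moved

col-drop⋆ : ∀ {L n} i (B : Mat L n) j → col (drop⋆ i B) j ≡ moveDown i (memFin j (unmatchedCols i B)) (col B j)
col-drop⋆ {n = n} i B j = tabulate-cong λ r → begin
  lookup (lookup (drop⋆ i B) r) j
    ≡⟨ cong (λ row → lookup row j) (lookup∘tabulate _ r) ⟩
  lookup (tabulate λ j → moveEntry i (S j) (rowNum r) (ball B r j)) j
    ≡⟨ lookup∘tabulate _ j ⟩
  moveEntry i (S j) (rowNum r) (ball B r j)
    ≡⟨ cong (moveEntry i (S j) (rowNum r)) (lookup∘tabulate _ r) ⟨
  moveEntry i (S j) (rowNum r) (lookup (col B j) r) ∎
  where
  open ≡-Reasoning
  S : Fin n → Bool
  S j = memFin j (unmatchedCols i B)

columns-drop⋆ : ∀ {L n} k (B : Mat L n) → columns (drop⋆ (suc k) B) ≡ proj₁ (run (dropStep k) 0 (columns B))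
columns-drop⋆ {n = n} k B = begin
  map (col (drop⋆ (suc k) B)) (allFin n)
    ≡⟨ map-cong (col-drop⋆ (suc k) B) (allFin n) ⟩
  map (λ j → moveDown (suc k) (memFin j (unmatchedCols (suc k) B)) (col B j)) (allFin n)
    ≡⟨ cong (λ U → map (λ j → moveDown (suc k) (memFin j U) (col B j)) (allFin n)) (unmatchedCols-markedColumns k B) ⟩
  map (λ j → moveDown (suc k) (memFin j (proj₁ (markedColumns k (col B) (allFin n)))) (col B j)) (allFin n)
    ≡⟨ proj₁ (markedColumns-run k (col B) (allFin n) (allFin⁺ n)) ⟩
  proj₁ (run (dropStep k) 0 (columns B)) ∎
  where open ≡-Reasoning

columns-drop⋆-after : ∀ {L n S} k (B : Mat L n) {M : Transducer S (Vec Bool L)} {s xs} →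
                      columns B ≡ proj₁ (run M s xs) →
                      columns (drop⋆ (suc k) B) ≡ proj₁ (run (dropStep k ⊙ M) (0 , s) xs)
columns-drop⋆-after k B {M} {s} {xs} eq = begin
  columns (drop⋆ (suc k) B)                        ≡⟨ columns-drop⋆ k B ⟩
  proj₁ (run (dropStep k) 0 (columns B))           ≡⟨ cong (proj₁ ∘ run (dropStep k) 0) eq ⟩
  proj₁ (run (dropStep k) 0 (proj₁ (run M s xs)))  ≡⟨ cong proj₁ (run-⊙ (dropStep k) M 0 s xs) ⟨
  proj₁ (run (dropStep k ⊙ M) (0 , s) xs)          ∎
  where open ≡-Reasoning

columns-drop⋆² : ∀ {L n} k l (B : Mat L n) →
                 columns (drop⋆ (suc k) (drop⋆ (suc l) B))
                 ≡ proj₁ (run (dropStep k ⊙ dropStep l) (0 , 0) (columns B))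
columns-drop⋆² k l B = columns-drop⋆-after k (drop⋆ (suc l) B) {dropStep l} {0} {columns B} (columns-drop⋆ l B)

columns-drop⋆³ : ∀ {L n} k l m (B : Mat L n) →
                 columns (drop⋆ (suc k) (drop⋆ (suc l) (drop⋆ (suc m) B)))
                 ≡ proj₁ (run (dropStep k ⊙ (dropStep l ⊙ dropStep m)) (0 , 0 , 0) (columns B))
columns-drop⋆³ k l m B =
  columns-drop⋆-after k (drop⋆ (suc l) (drop⋆ (suc m) B)) {dropStep l ⊙ dropStep m} {0 , 0} {columns B}
                      (columns-drop⋆² l m B)

map-≡⇒∈-≡ : ∀ {A B : Set} {f g : A → B} {xs x} → map f xs ≡ map g xs → x ∈ xs → f x ≡ g x
map-≡⇒∈-≡ {xs = _ ∷ _} eq (here refl) = ∷-injectiveˡ eq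
map-≡⇒∈-≡ {xs = _ ∷ _} eq (there x∈)  = map-≡⇒∈-≡ (∷-injectiveʳ eq) x∈

columns-injective : ∀ {L n} {B B′ : Mat L n} → columns B ≡ columns B′ → B ≡ B′
columns-injective {B = B} {B′} eq = begin
  B                            ≡⟨ tabulate∘lookup B ⟨
  tabulate (λ r → lookup B r)  ≡⟨ tabulate-cong (λ r → trans (sym (tabulate∘lookup (lookup B r)))
                                    (trans (tabulate-cong (ball-≡ r)) (tabulate∘lookup (lookup B′ r)))) ⟩
  tabulate (λ r → lookup B′ r) ≡⟨ tabulate∘lookup B′ ⟩
  B′                           ∎
  where
  open ≡-Reasoning
  ball-≡ : ∀ r j → ball B r j ≡ ball B′ r j
  ball-≡ r j = begin
    ball B r j          ≡⟨ lookup∘tabulate _ r ⟨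
    lookup (col B j) r  ≡⟨ cong (λ v → lookup v r) (map-≡⇒∈-≡ eq (∈-allFin j)) ⟩
    lookup (col B′ j) r ≡⟨ lookup∘tabulate _ r ⟩
    ball B′ r j         ∎

Triple : Set
Triple = Bool × Bool × Bool

dropLow : Transducer ℕ Triple
dropLow c (p , q , r) = (p ∨ dropFlag p q c , q ∧ not (dropFlag p q c) , r) , pending p q c

dropHigh : Transducer ℕ Triple
dropHigh c (p , q , r) = (p , q ∨ dropFlag q r c , r ∧ not (dropFlag q r c)) , pending q r c

window : ∀ {L} → ℕ → Vec Bool L → Triple
window k v = bit v k , bit v (suc k) , bit v (suc (suc k))

Outside : ℕ → ℕ → Set
Outside k m = m ≢ k × m ≢ suc k × m ≢ suc (suc k)

window-ext : ∀ {L} k {v w : Vec Bool L} → window k v ≡ window k w →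
             (∀ m → Outside k m → bit v m ≡ bit w m) → v ≡ w
window-ext k {v} {w} same outside = bit-ext pointwise
  where
  pointwise : ∀ m → bit v m ≡ bit w m
  pointwise m with m ≟ k | m ≟ suc k | m ≟ suc (suc k)
  ... | yes refl | _        | _        = cong proj₁ same
  ... | no _     | yes refl | _        = cong (proj₁ ∘ proj₂) same
  ... | no _     | no _     | yes refl = cong (proj₂ ∘ proj₂) same
  ... | no m≢k   | no m≢k+1 | no m≢k+2 = outside m (m≢k , m≢k+1 , m≢k+2)

record Tracks {S L} (k : ℕ) (M : Transducer S (Vec Bool L)) (M₃ : Transducer S Triple) : Set where
  constructor tracking
  field
    step : ∀ s v → window k (proj₁ (M s v)) ≡ proj₁ (M₃ s (window k v))
                 × proj₂ (M s v) ≡ proj₂ (M₃ s (window k v))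
                 × (∀ m → Outside k m → bit (proj₁ (M s v)) m ≡ bit v m)

⊙-tracks : ∀ {S T L k} {M : Transducer S (Vec Bool L)} {N : Transducer T (Vec Bool L)} {M₃ N₃} →
           Tracks k M M₃ → Tracks k N N₃ → Tracks k (M ⊙ N) (M₃ ⊙ N₃)
⊙-tracks {N = N} {M₃} (tracking trackM) (tracking trackN) = tracking λ (s , t) v →
  let windowN , stateN , outsideN = trackN t v
      windowM , stateM , outsideM = trackM s (proj₁ (N t v))
  in trans windowM (cong (proj₁ ∘ M₃ s) windowN)
   , cong₂ _,_ (trans stateM (cong (proj₂ ∘ M₃ s) windowN)) stateN
   , λ m out → trans (outsideM m out) (outsideN m out)

tracks-simulation : ∀ {S T L k} {M : Transducer S (Vec Bool L)} {N : Transducer T (Vec Bool L)} {M₃ N₃ R} →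
                    Tracks k M M₃ → Tracks k N N₃ → Simulation M₃ N₃ R → Simulation M N R
tracks-simulation {k = k} {R = R} (tracking trackM) (tracking trackN) sim {s} {t} v r =
  let windowM , stateM , outsideM = trackM s v
      windowN , stateN , outsideN = trackN t v
      sameOut , related = sim (window k v) r
  in window-ext k (trans windowM (trans sameOut (sym windowN)))
                  (λ m out → trans (outsideM m out) (sym (outsideN m out)))
   , subst₂ R (sym stateM) (sym stateN) related

module _ {L : ℕ} (k : ℕ) where

  dropStep-tracks-dropLow : suc k < L → Tracks {L = L} k (dropStep k) dropLow
  dropStep-tracks-dropLow k+1<L = tracking λ c v →
    cong₂ _,_ (bit-moveDown-lower k (dropFlagAt k c v) v (<⇒≤ k+1<L))
      (cong₂ _,_ (bit-moveDown-upper k (dropFlagAt k c v) v k+1<L)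
                 (bit-moveDown-other k (dropFlagAt k c v) v (suc (suc k)) (λ ()) (λ ())))
    , refl
    , λ m (m≢k , m≢k+1 , _) → bit-moveDown-other k (dropFlagAt k c v) v m m≢k m≢k+1

  dropStep-tracks-dropHigh : suc (suc k) < L → Tracks {L = L} k (dropStep (suc k)) dropHigh
  dropStep-tracks-dropHigh k+2<L = tracking λ c v →
    cong₂ _,_ (bit-moveDown-other (suc k) (dropFlagAt (suc k) c v) v k (λ ()) (λ ()))
      (cong₂ _,_ (bit-moveDown-lower (suc k) (dropFlagAt (suc k) c v) v (<⇒≤ k+2<L))
                 (bit-moveDown-upper (suc k) (dropFlagAt (suc k) c v) v k+2<L))
    , refl
    , λ m (_ , m≢k+1 , m≢k+2) → bit-moveDown-other (suc k) (dropFlagAt (suc k) c v) v m m≢k+1 m≢k+2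

-- (i) Idempotence

-- The counter of the second pass stays at least that of the first, so the second pass never
-- drops a ball.
Dominated : ℕ × ℕ → ℕ → Set
Dominated (b , a) t = a ≡ t × a ≤ b

dropLow-idempotent : Simulation (dropLow ⊙ dropLow) dropLow Dominated
dropLow-idempotent                   (false , false , r) (refl , a≤b)     = refl , refl , a≤b
dropLow-idempotent {_ , zero}        (false , true , r)  (refl , _)       = refl , refl , z≤n
dropLow-idempotent {suc b , suc a}   (false , true , r)  (refl , s≤s a≤b) = refl , refl , a≤b
dropLow-idempotent                   (true , false , r)  (refl , a≤b)     = refl , refl , s≤s a≤b
dropLow-idempotent                   (true , true , r)   (refl , a≤b)     = refl , refl , a≤b

drop⋆-idempotent : ∀ {L n} k → suc k < L → (B : Mat L n) → drop⋆ (suc k) (drop⋆ (suc k) B) ≡ drop⋆ (suc k) B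
drop⋆-idempotent k k+1<L B = columns-injective (begin
  columns (drop⋆ (suc k) (drop⋆ (suc k) B))
    ≡⟨ columns-drop⋆² k k B ⟩
  proj₁ (run (dropStep k ⊙ dropStep k) (0 , 0) (columns B))
    ≡⟨ proj₁ (run-simulation simulation (refl , z≤n) (columns B)) ⟩
  proj₁ (run (dropStep k) 0 (columns B))
    ≡⟨ columns-drop⋆ k B ⟨
  columns (drop⋆ (suc k) B) ∎)
  where
  open ≡-Reasoning
  tracks : Tracks k (dropStep k) dropLow
  tracks = dropStep-tracks-dropLow k k+1<L
  simulation : Simulation (dropStep k ⊙ dropStep k) (dropStep k) Dominated
  simulation = tracks-simulation (⊙-tracks tracks tracks) tracks dropLow-idempotent

-- (ii) Commutation

moveEntry-comm : ∀ {i j} → suc i < j → ∀ S T m b →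
                 moveEntry i S m (moveEntry j T m b) ≡ moveEntry j T m (moveEntry i S m b)
moveEntry-comm {i} {j} i+1<j S T m b with m ≟ i | m ≟ suc i
... | yes refl | _ =
  trans (cong (moveEntry i S i) (moveEntry-outside i≢j i≢j+1 T b)) (sym (moveEntry-outside i≢j i≢j+1 T _))
  where i≢j = <⇒≢ (<⇒≤ i+1<j) ; i≢j+1 = <⇒≢ (m<n⇒m<1+n (<⇒≤ i+1<j))
... | no _ | yes refl =
  trans (cong (moveEntry i S (suc i)) (moveEntry-outside i+1≢j i+1≢j+1 T b))
        (sym (moveEntry-outside i+1≢j i+1≢j+1 T _))
  where i+1≢j = <⇒≢ i+1<j ; i+1≢j+1 = <⇒≢ (m<n⇒m<1+n i+1<j)
... | no m≢i | no m≢i+1 =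
  trans (moveEntry-outside m≢i m≢i+1 S _) (cong (moveEntry j T m) (sym (moveEntry-outside m≢i m≢i+1 S b)))

moveDown-comm : ∀ {L i j} → suc i < j → ∀ S T (v : Vec Bool L) →
                moveDown i S (moveDown j T v) ≡ moveDown j T (moveDown i S v)
moveDown-comm {i = i} {j} i+1<j S T v = tabulate-cong λ r → begin
  moveEntry i S (rowNum r) (lookup (moveDown j T v) r)
    ≡⟨ cong (moveEntry i S (rowNum r)) (lookup∘tabulate _ r) ⟩
  moveEntry i S (rowNum r) (moveEntry j T (rowNum r) (lookup v r))
    ≡⟨ moveEntry-comm i+1<j S T (rowNum r) (lookup v r) ⟩
  moveEntry j T (rowNum r) (moveEntry i S (rowNum r) (lookup v r))
    ≡⟨ cong (moveEntry j T (rowNum r)) (lookup∘tabulate _ r) ⟨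
  moveEntry j T (rowNum r) (lookup (moveDown i S v) r) ∎
  where open ≡-Reasoning

Apart : ℕ → ℕ → Set
Apart k l = k ≢ l × k ≢ suc l × suc k ≢ l × suc k ≢ suc l

Apart-sym : ∀ {k l} → Apart k l → Apart l k
Apart-sym (k≢l , k≢l+1 , k+1≢l , k+1≢l+1) = ≢-sym k≢l , ≢-sym k+1≢l , ≢-sym k≢l+1 , ≢-sym k+1≢l+1

<⇒Apart : ∀ {k l} → suc k < l → Apart k l
<⇒Apart k+1<l = <⇒≢ (<⇒≤ k+1<l) , <⇒≢ (m<n⇒m<1+n (<⇒≤ k+1<l)) , <⇒≢ k+1<l , <⇒≢ (m<n⇒m<1+n k+1<l)

⊙-dropStep-apart : ∀ {L k l} → Apart k l → ∀ c d (v : Vec Bool L) →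
  (dropStep k ⊙ dropStep l) (c , d) v ≡
  ( moveDown (suc k) (dropFlagAt k c v) (moveDown (suc l) (dropFlagAt l d v) v)
  , pendingAt k c v , pendingAt l d v)
⊙-dropStep-apart {k = k} {l} (k≢l , k≢l+1 , k+1≢l , k+1≢l+1) c d v
  rewrite bit-moveDown-other l (dropFlagAt l d v) v k k≢l k≢l+1
        | bit-moveDown-other l (dropFlagAt l d v) v (suc k) k+1≢l k+1≢l+1 = refl

Swapped : ℕ × ℕ → ℕ × ℕ → Set
Swapped (c , d) (d′ , c′) = c ≡ c′ × d ≡ d′

dropStep-commute : ∀ {L k l} → suc k < l →
                   Simulation {X = Vec Bool L} (dropStep k ⊙ dropStep l) (dropStep l ⊙ dropStep k) Swapped
dropStep-commute {k = k} {l} k+1<l {c , d} {d′ , c′} v (refl , refl) =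
  trans (cong proj₁ kl)
        (trans (moveDown-comm (s≤s k+1<l) (dropFlagAt k c v) (dropFlagAt l d v) v) (sym (cong proj₁ lk)))
  , cong (proj₁ ∘ proj₂) kl , sym (cong (proj₁ ∘ proj₂) lk)
  where
  kl : (dropStep k ⊙ dropStep l) (c , d) v
       ≡ (moveDown (suc k) (dropFlagAt k c v) (moveDown (suc l) (dropFlagAt l d v) v) , pendingAt k c v , pendingAt l d v)
  kl = ⊙-dropStep-apart (<⇒Apart k+1<l) c d v
  lk : (dropStep l ⊙ dropStep k) (d , c) v
       ≡ (moveDown (suc l) (dropFlagAt l d v) (moveDown (suc k) (dropFlagAt k c v) v) , pendingAt l d v , pendingAt k c v)
  lk = ⊙-dropStep-apart (Apart-sym (<⇒Apart k+1<l)) d c v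

drop⋆-commute : ∀ {L n} k l → suc k < l → (B : Mat L n) →
                drop⋆ (suc k) (drop⋆ (suc l) B) ≡ drop⋆ (suc l) (drop⋆ (suc k) B)
drop⋆-commute k l k+1<l B = columns-injective (begin
  columns (drop⋆ (suc k) (drop⋆ (suc l) B))
    ≡⟨ columns-drop⋆² k l B ⟩
  proj₁ (run (dropStep k ⊙ dropStep l) (0 , 0) (columns B))
    ≡⟨ proj₁ (run-simulation (dropStep-commute k+1<l) (refl , refl) (columns B)) ⟩
  proj₁ (run (dropStep l ⊙ dropStep k) (0 , 0) (columns B))
    ≡⟨ columns-drop⋆² l k B ⟨
  columns (drop⋆ (suc l) (drop⋆ (suc k) B)) ∎)
  where open ≡-Reasoning

-- (iii) The braid relation

-- Let a, b, c be the counters of the first, second and third pass of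
-- dropLow ⊙ (dropHigh ⊙ dropLow), stored as (c , b , a), and x, y, z those of
-- dropHigh ⊙ (dropLow ⊙ dropHigh). Then y = min(a, c), x = b + (c ∸ a) and z = b + (a ∸ c)
-- throughout, so both triples are functions of y, b and the signed gap g = c − a.
lowCounters : ℕ × ℕ × ℤ → ℕ × ℕ × ℕ
lowCounters (y , b , + n)      = y + n , b , y
lowCounters (y , b , -[1+ n ]) = y , b , suc (y + n)

highCounters : ℕ × ℕ × ℤ → ℕ × ℕ × ℕ
highCounters (y , b , + n)      = b , y , b + n
highCounters (y , b , -[1+ n ]) = suc (b + n) , y , b

BraidInvariant : ℕ × ℕ × ℕ → ℕ × ℕ × ℕ → Set
BraidInvariant s t = Σ (ℕ × ℕ × ℤ) λ P → lowCounters P ≡ s × highCounters P ≡ t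

braidLow braidHigh : Transducer (ℕ × ℕ × ℕ) Triple
braidLow  = dropLow ⊙ (dropHigh ⊙ dropLow)
braidHigh = dropHigh ⊙ (dropLow ⊙ dropHigh)

BraidStep : ℕ × ℕ × ℤ → Triple → Set
BraidStep P x = proj₁ (braidLow (lowCounters P) x) ≡ proj₁ (braidHigh (highCounters P) x)
              × BraidInvariant (proj₂ (braidLow (lowCounters P) x)) (proj₂ (braidHigh (highCounters P) x))

braid-step : ∀ P x → BraidStep P x
braid-step P (false , false , false) = refl , P , refl , refl
braid-step P (true , true , true)    = refl , P , refl , refl
braid-step (y , b , + n)      (true , false , false) = refl , (suc y , b , + n) , refl , refl
braid-step (y , b , -[1+ n ]) (true , false , false) = refl , (suc y , b , -[1+ n ]) , refl , refl
braid-step (y , b , + n)      (true , true , false)  = refl , (y , suc b , + n) , refl , refl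
braid-step (y , b , -[1+ n ]) (true , true , false)  = refl , (y , suc b , -[1+ n ]) , refl , refl
braid-step (y , suc b , + n)      (true , false , true) = refl , (suc y , b , + n) , refl , refl
braid-step (y , suc b , -[1+ n ]) (true , false , true) = refl , (suc y , b , -[1+ n ]) , refl , refl
braid-step (y , zero , + suc n)   (true , false , true) rewrite +-suc y n =
  refl , (suc y , zero , + n) , refl , refl
braid-step (y , zero , + zero)    (true , false , true) =
  refl , (y , zero , -[1+ 0 ]) , cong₂ (λ u w → u , 0 , suc w) (sym (+-identityʳ y)) (+-identityʳ y) , refl
braid-step (y , zero , -[1+ n ])  (true , false , true) rewrite sym (+-suc y n) =
  refl , (y , zero , -[1+ suc n ]) , refl , refl
braid-step (y , suc b , + n)         (false , false , true) = refl , (y , b , + n) , refl , refl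
braid-step (y , suc b , -[1+ n ])    (false , false , true) = refl , (y , b , -[1+ n ]) , refl , refl
braid-step (y , zero , + suc n)      (false , false , true) rewrite +-suc y n =
  refl , (y , zero , + n) , refl , refl
braid-step (zero , zero , + zero)    (false , false , true) = refl , (zero , zero , + zero) , refl , refl
braid-step (suc y , zero , + zero)   (false , false , true) =
  refl , (y , zero , -[1+ 0 ]) , cong₂ (λ u w → u , 0 , suc w) (sym (+-identityʳ y)) (+-identityʳ y) , refl
braid-step (zero , zero , -[1+ n ])  (false , false , true) = refl , (zero , zero , -[1+ n ]) , refl , refl
braid-step (suc y , zero , -[1+ n ]) (false , false , true) rewrite sym (+-suc y n) =
  refl , (y , zero , -[1+ suc n ]) , refl , refl
braid-step (suc y , b , + n)           (false , true , false) = refl , (y , suc b , + n) , refl , refl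
braid-step (suc y , b , -[1+ n ])      (false , true , false) = refl , (y , suc b , -[1+ n ]) , refl , refl
braid-step (zero , b , + n)            (false , true , false) rewrite sym (+-suc b n) =
  refl , (zero , b , + suc n) , refl , refl
braid-step (zero , b , -[1+ zero ])    (false , true , false) rewrite +-identityʳ b =
  refl , (zero , suc b , + zero) , refl , cong (λ w → suc b , 0 , suc w) (+-identityʳ b)
braid-step (zero , b , -[1+ suc n ])   (false , true , false) rewrite +-suc b n =
  refl , (zero , suc b , -[1+ n ]) , refl , refl
braid-step (suc y , b , + n)           (false , true , true) = refl , (y , b , + n) , refl , refl
braid-step (suc y , b , -[1+ n ])      (false , true , true) = refl , (y , b , -[1+ n ]) , refl , refl
braid-step (zero , zero , + n)         (false , true , true) = refl , (zero , zero , + n) , refl , refl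
braid-step (zero , suc b , + n)        (false , true , true) rewrite sym (+-suc b n) =
  refl , (zero , b , + suc n) , refl , refl
braid-step (zero , b , -[1+ zero ])    (false , true , true) rewrite +-identityʳ b =
  refl , (zero , b , + zero) , refl , cong (λ w → b , 0 , w) (+-identityʳ b)
braid-step (zero , b , -[1+ suc n ])   (false , true , true) rewrite +-suc b n =
  refl , (zero , b , -[1+ n ]) , refl , refl

braid-window : Simulation braidLow braidHigh BraidInvariant
braid-window x (P , refl , refl) = braid-step P x

drop⋆-braid : ∀ {L n} k → suc (suc k) < L → (B : Mat L n) →
              drop⋆ (suc k) (drop⋆ (suc (suc k)) (drop⋆ (suc k) B))
              ≡ drop⋆ (suc (suc k)) (drop⋆ (suc k) (drop⋆ (suc (suc k)) B))
drop⋆-braid k k+2<L B = columns-injective (begin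
  columns (drop⋆ (suc k) (drop⋆ (suc (suc k)) (drop⋆ (suc k) B)))
    ≡⟨ columns-drop⋆³ k (suc k) k B ⟩
  proj₁ (run (dropStep k ⊙ (dropStep (suc k) ⊙ dropStep k)) (0 , 0 , 0) (columns B))
    ≡⟨ proj₁ (run-simulation simulation ((0 , 0 , + 0) , refl , refl) (columns B)) ⟩
  proj₁ (run (dropStep (suc k) ⊙ (dropStep k ⊙ dropStep (suc k))) (0 , 0 , 0) (columns B))
    ≡⟨ columns-drop⋆³ (suc k) k (suc k) B ⟨
  columns (drop⋆ (suc (suc k)) (drop⋆ (suc k) (drop⋆ (suc (suc k)) B))) ∎)
  where
  open ≡-Reasoning
  low : Tracks k (dropStep k) dropLow
  low = dropStep-tracks-dropLow k (<⇒≤ k+2<L)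
  high : Tracks k (dropStep (suc k)) dropHigh
  high = dropStep-tracks-dropHigh k k+2<L
  simulation : Simulation (dropStep k ⊙ (dropStep (suc k) ⊙ dropStep k))
                          (dropStep (suc k) ⊙ (dropStep k ⊙ dropStep (suc k))) BraidInvariant
  simulation = tracks-simulation (⊙-tracks low (⊙-tracks high low)) (⊙-tracks high (⊙-tracks low high))
                                 braid-window

theorem4p6 : (L n : ℕ) → 1 ≤ L → 1 ≤ n →
    ((i : ℕ) → 1 ≤ i → i + 1 ≤ L → (B : Mat L n) →
        drop⋆ i (drop⋆ i B) ≡ drop⋆ i B)
    × ((i j : ℕ) → 1 ≤ i → i + 1 ≤ L → 1 ≤ j → j + 1 ≤ L → (i + 2 ≤ j ⊎ j + 2 ≤ i) →
        (B : Mat L n) → drop⋆ i (drop⋆ j B) ≡ drop⋆ j (drop⋆ i B))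
    × ((i : ℕ) → 1 ≤ i → i + 2 ≤ L → (B : Mat L n) →
        drop⋆ i (drop⋆ (i + 1) (drop⋆ i B)) ≡ drop⋆ (i + 1) (drop⋆ i (drop⋆ (i + 1) B)))
theorem4p6 L n _ _ = idempotent , commute , braid
  where
  swap-+ : ∀ m d {k} → m + d ≤ k → d + m ≤ k
  swap-+ m d {k} = subst (_≤ k) (+-comm m d)
  idempotent : (i : ℕ) → 1 ≤ i → i + 1 ≤ L → (B : Mat L n) → drop⋆ i (drop⋆ i B) ≡ drop⋆ i B
  idempotent (suc k) _ i+1≤L = drop⋆-idempotent k (swap-+ (suc k) 1 i+1≤L)
  commute : (i j : ℕ) → 1 ≤ i → i + 1 ≤ L → 1 ≤ j → j + 1 ≤ L → (i + 2 ≤ j ⊎ j + 2 ≤ i) →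
            (B : Mat L n) → drop⋆ i (drop⋆ j B) ≡ drop⋆ j (drop⋆ i B)
  commute (suc k) (suc l) _ _ _ _ (inj₁ (s≤s k+2≤l))   = drop⋆-commute k l (swap-+ k 2 k+2≤l)
  commute (suc k) (suc l) _ _ _ _ (inj₂ (s≤s l+2≤k)) B = sym (drop⋆-commute l k (swap-+ l 2 l+2≤k) B)
  braid : (i : ℕ) → 1 ≤ i → i + 2 ≤ L → (B : Mat L n) →
          drop⋆ i (drop⋆ (i + 1) (drop⋆ i B)) ≡ drop⋆ (i + 1) (drop⋆ i (drop⋆ (i + 1) B))
  braid (suc k) _ i+2≤L rewrite +-comm k 1 = drop⋆-braid k (swap-+ (suc k) 2 i+2≤L)
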